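{- Consider the set of fully commutative elements of $S_n$, partially ordered by the right weak order. The uncrowded permutations form an order ideal of this poset, and the crowded permutations form a dual order ideal of this poset.
   Context: A permutation is fully commutative iff it avoids $321$. The right weak order on $S_n$ is the transitive closure of the relations $w < ws_i$ whenever $\ell(ws_i) > \ell(w)$, where $s_i$ swaps $i,i+1$ and $\ell$ is Coxeter length. An order ideal is a down-closed subset, a dual order ideal is an up-closed subset. $P(w)$ is the RSK insertion tableau, $\mathrm{Row}_2$ the set of its second-row entries. A set $L$ of integers is crowded if there exist integers $x>0$ and $y$ with $|[y,y+2x]\cap L| > x+1$, uncrowded otherwise; a fully commutative $w$ is crowded/uncrowded according to $\mathrm{Row}_2(P(w))$. -}

module Defs where

open import Data.Nat using (ℕ; zero; suc; _+_; _*_; _<_; _>_; _<?_)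
open import Data.Integer as ℤ using (ℤ; +_)
open import Data.List using (List; []; _∷_; [_]; length; filter; map; upTo; foldl)
open import Data.List.Relation.Binary.Permutation.Propositional using (_↭_)
open import Data.List.Relation.Binary.Sublist.Propositional using (_⊆_)
open import Data.Product using (Σ; ∃; _×_; _,_)
open import Relation.Nullary using (¬_; yes; no)
open import Relation.Nullary.Decidable using (_×-dec_)
open import Relation.Binary.Construct.Closure.ReflexiveTransitive using (Star)

-- Permutations of {1,…,n} in one-line notation w = [w(1), …, w(n)].
IsPerm : ℕ → List ℕ → Set
IsPerm n w = w ↭ map suc (upTo n)

-- Coxeter length of a permutation of S_n = number of inversions.
inv : List ℕ → ℕ
inv []       = 0
inv (x ∷ xs) = length (filter (_<? x) xs) + inv xs

-- w s_i : swap the entries in positions i and i+1 (positions 0-based here).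
swapAt : ℕ → List ℕ → List ℕ
swapAt zero    (a ∷ b ∷ xs) = b ∷ a ∷ xs
swapAt (suc i) (x ∷ xs)     = x ∷ swapAt i xs
swapAt _       xs           = xs

data WeakStep : List ℕ → List ℕ → Set where
  step : ∀ {w} (i : ℕ) → suc i < length w → inv w < inv (swapAt i w) →
         WeakStep w (swapAt i w)

_≤R_ : List ℕ → List ℕ → Set
_≤R_ = Star WeakStep

-- Fully commutative = 321-avoiding: no subsequence c , b , a with c > b > a.
FullyCommutative : List ℕ → Set
FullyCommutative w = ¬ (Σ ℕ λ c → Σ ℕ λ b → Σ ℕ λ a →
                        (c ∷ b ∷ a ∷ []) ⊆ w × c > b × b > a)

data Bump : Set where
  none : Bump
  bump : ℕ → Bump

rowInsert : ℕ → List ℕ → List ℕ × Bump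
rowInsert x [] = (x ∷ [] , none)
rowInsert x (y ∷ ys) with x <? y
... | yes _ = (x ∷ ys , bump y)
... | no  _ with rowInsert x ys
...   | (ys' , b) = (y ∷ ys' , b)

-- Insert x into a tableau (list of rows, top row first).
tabInsert : ℕ → List (List ℕ) → List (List ℕ)
tabInsert x []         = (x ∷ []) ∷ []
tabInsert x (r ∷ rs) with rowInsert x r
... | (r' , none)   = r' ∷ rs
... | (r' , bump y) = r' ∷ tabInsert y rs

P : List ℕ → List (List ℕ)
P w = foldl (λ T x → tabInsert x T) [] w

Row2 : List (List ℕ) → List ℕ
Row2 (_ ∷ r ∷ _) = r
Row2 _           = []

countIn : ℤ → ℕ → List ℕ → ℕ
countIn y x L = length (filter (λ l → (y ℤ.≤? + l) ×-dec (+ l ℤ.≤? y ℤ.+ + (2 * x))) L)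

CrowdedSet : List ℕ → Set
CrowdedSet L = Σ ℕ λ x → Σ ℤ λ y → (x > 0) × (countIn y x L > x + 1)

Crowded : List ℕ → Set
Crowded w = CrowdedSet (Row2 (P w))

Uncrowded : List ℕ → Set
Uncrowded w = ¬ Crowded w

-- For a word with distinct entries avoiding 321, Schensted insertion produces at most two rows:
-- the entry bumped out of row 1 exceeds every entry of row 2 (otherwise an earlier descent s c of
-- the word would form the pattern s c x with the inserted x), so it is appended to row 2.
-- A cover u a b t < u b a t of the right weak order (a < b) changes the tableaux obtained after
-- u a b and after u b a at most by one entry lying in row 1 of the former and in row 2 of the
-- latter, and inserting the common suffix t preserves this relation. Hence Row₂(P w) only grows
-- along the weak order, and crowdedness of a set is monotone under inclusion.

module Submission where

open import Defs

open import Data.Empty using (⊥; ⊥-elim)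
open import Data.List using (List; []; _∷_; [_]; _++_; length; filter)
open import Data.List.Properties using (foldl-++; ++-assoc; ++-identityʳ; filter-reject)
open import Data.List.Membership.Propositional using (_∈_; _∉_)
open import Data.List.Membership.Propositional.Properties using (∈-++⁺ˡ; ∈-++⁺ʳ; ∈-++⁻)
open import Data.List.Relation.Unary.Any using (here; there)
open import Data.List.Relation.Unary.All as All using (All; []; _∷_)
open import Data.List.Relation.Unary.AllPairs using (AllPairs; []; _∷_)
import Data.List.Relation.Unary.AllPairs.Properties as AllPairs
open import Data.List.Relation.Unary.Unique.Propositional using (Unique)
open import Data.List.Relation.Unary.Unique.Propositional.Properties using (Unique[x∷xs]⇒x∉xs; map⁺; upTo⁺)
open import Data.List.Relation.Binary.Permutation.Propositional using (_↭_; ↭⇒↭ₛ; ↭-sym; refl; swap)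
open import Data.List.Relation.Binary.Permutation.Propositional.Properties using (++-comm; ++⁺ˡ; filter-↭; ↭-length)
import Data.List.Relation.Binary.Permutation.Setoid.Properties as ↭ₛ
open import Data.List.Relation.Binary.Sublist.Propositional using (_⊆_; []; _∷_; _∷ʳ_; ⊆-refl; ⊆-trans; from∈; minimum)
open import Data.List.Relation.Binary.Sublist.Propositional.Properties using (++⁺; ++⁺ʳ; All-resp-⊆; filter⁺; length-mono-≤)
open import Data.List.Reverse using (Reverse; []; _∶_∶ʳ_; reverseView)
open import Data.Nat using (ℕ; zero; suc; _+_; _<_; _≤_; _<?_; _≟_; s≤s)
open import Data.Nat.Properties
open import Algebra.Properties.CommutativeSemigroup +-commutativeSemigroup using (x∙yz≈y∙xz)
open import Data.Product using (Σ; ∃-syntax; _×_; _,_; proj₁; proj₂)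
open import Data.Sum as Sum using (_⊎_; inj₁; inj₂)
open import Function using (_∘_; id)
open import Relation.Binary.Construct.Closure.ReflexiveTransitive using (ε; _◅_)
open import Relation.Binary.Definitions using (tri<; tri≈; tri>)
open import Relation.Binary.PropositionalEquality using (_≡_; _≢_; refl; sym; trans; cong; subst; subst₂; setoid)
open import Relation.Nullary using (¬_; yes; no; contradiction)
open import Relation.Unary using (_≐_; _∪_; ｛_｝)

-- Distinct and 321-avoiding words

Increasing : List ℕ → Set
Increasing = AllPairs _<_

increasing-sublist : ∀ {xs ys} → Increasing xs → Increasing ys → (∀ {k} → k ∈ xs → k ∈ ys) → xs ⊆ ys
increasing-sublist {[]}     _           _           _   = minimum _
increasing-sublist {x ∷ xs} {[]}        _           _   xs⊆ with xs⊆ (here refl)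
... | ()
increasing-sublist {x ∷ xs} {y ∷ ys} (x<xs ∷ xs↑) (y<ys ∷ ys↑) xs⊆ with x ≟ y
... | yes refl = refl ∷ increasing-sublist xs↑ ys↑ tail⊆
  where
  tail⊆ : ∀ {k} → k ∈ xs → k ∈ ys
  tail⊆ k∈ with xs⊆ (there k∈)
  ... | here refl = contradiction (All.lookup x<xs k∈) (<-irrefl refl)
  ... | there k∈ys = k∈ys
... | no x≢y = y ∷ʳ increasing-sublist (x<xs ∷ xs↑) ys↑ ⊆ys
  where
  y<x : y < x
  y<x with xs⊆ (here refl)
  ... | here x≡y  = contradiction x≡y x≢y
  ... | there x∈ys = All.lookup y<ys x∈ys
  ⊆ys : ∀ {k} → k ∈ x ∷ xs → k ∈ ys
  ⊆ys k∈ with xs⊆ k∈ | k∈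
  ... | there k∈ys | _         = k∈ys
  ... | here refl  | here y≡x  = contradiction (sym y≡x) x≢y
  ... | here refl  | there y∈xs = contradiction (All.lookup x<xs y∈xs) (<-asym y<x)

Unique-resp-↭ : ∀ {a} {A : Set a} {xs ys : List A} → xs ↭ ys → Unique xs → Unique ys
Unique-resp-↭ xs↭ys = ↭ₛ.Unique-resp-↭ (setoid _) (↭⇒↭ₛ xs↭ys)

Unique-∷ʳ⇒∉ : ∀ {a} {A : Set a} {v : List A} {x} → Unique (v ++ [ x ]) → x ∉ v
Unique-∷ʳ⇒∉ {v = v} {x = x} un = Unique[x∷xs]⇒x∉xs (Unique-resp-↭ (++-comm v [ x ]) un)

AllPairs-resp-⊇ : ∀ {a r} {A : Set a} {R : A → A → Set r} {xs ys : List A} →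
                  xs ⊆ ys → AllPairs R ys → AllPairs R xs
AllPairs-resp-⊇ []         []        = []
AllPairs-resp-⊇ (_ ∷ʳ xs⊆) (_ ∷ rs)  = AllPairs-resp-⊇ xs⊆ rs
AllPairs-resp-⊇ (refl ∷ xs⊆) (r ∷ rs) = All-resp-⊆ xs⊆ r ∷ AllPairs-resp-⊇ xs⊆ rs

Unique-++⁻ˡ : ∀ {a} {A : Set a} {v : List A} t → Unique (v ++ t) → Unique v
Unique-++⁻ˡ t = AllPairs-resp-⊇ (++⁺ʳ t ⊆-refl)

IsPerm⇒Unique : ∀ n {w} → IsPerm n w → Unique w
IsPerm⇒Unique n w↭ = Unique-resp-↭ (↭-sym w↭) (map⁺ suc-injective (upTo⁺ n))

FC-resp-⊇ : ∀ {xs ys} → xs ⊆ ys → FullyCommutative ys → FullyCommutative xs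
FC-resp-⊇ xs⊆ys fc (c , b , a , cba⊆xs , b<c , a<b) = fc (c , b , a , ⊆-trans cba⊆xs xs⊆ys , b<c , a<b)

FC-++⁻ˡ : ∀ {v} t → FullyCommutative (v ++ t) → FullyCommutative v
FC-++⁻ˡ t = FC-resp-⊇ (++⁺ʳ t ⊆-refl)

FC-descent-≤ : ∀ {u x s c} → FullyCommutative (u ++ [ x ]) → (s ∷ c ∷ []) ⊆ u → c < s → c ≤ x
FC-descent-≤ fc sc c<s = ≮⇒≥ (λ x<c → fc (_ , _ , _ , ++⁺ sc ⊆-refl , c<s , x<c))

-- Row insertion

Bumps : ℕ → List ℕ → Bump → Set
Bumps x R none     = ∀ {r} → r ∈ R → r ≤ x
Bumps x R (bump y) = y ∈ R × x < y × (∀ {r} → r ∈ R → x < r → y ≤ r)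

record RowInsertion (x : ℕ) (R R′ : List ℕ) (b : Bump) : Set where
  field
    bumps      : Bumps x R b
    ∈-row⁻     : ∀ {k} → k ∈ R′ → k ≡ x ⊎ (k ∈ R × b ≢ bump k)
    ∈-row⁺     : ∀ {k} → k ≡ x ⊎ (k ∈ R × b ≢ bump k) → k ∈ R′
    increasing : Increasing R′

Bumps-∷ : ∀ {x y ys} → y ≤ x → ∀ b → Bumps x ys b → Bumps x (y ∷ ys) b
Bumps-∷ y≤x none     below (here refl) = y≤x
Bumps-∷ y≤x none     below (there r∈) = below r∈
Bumps-∷ y≤x (bump z) (z∈ , x<z , least) = there z∈ , x<z , least′
  where
  least′ : ∀ {r} → r ∈ _ → _ < r → z ≤ r
  least′ (here refl) x<y = contradiction y≤x (<⇒≱ x<y)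
  least′ (there r∈)  x<r = least r∈ x<r

Bumps-functional : ∀ {x R} b b′ → Bumps x R b → Bumps x R b′ → b ≡ b′
Bumps-functional none     none      _                 _                    = refl
Bumps-functional none     (bump y)  below             (y∈ , x<y , _)       = contradiction (below y∈) (<⇒≱ x<y)
Bumps-functional (bump y) none      (y∈ , x<y , _)    below                = contradiction (below y∈) (<⇒≱ x<y)
Bumps-functional (bump y) (bump y′) (y∈ , x<y , least) (y′∈ , x<y′ , least′) =
  cong bump (≤-antisym (least y′∈ x<y′) (least′ y∈ x<y))

Bumps-resp : ∀ {x R R′} b → Bumps x R b →
             (∀ {k} → x < k → k ∈ R → k ∈ R′) → (∀ {k} → x < k → k ∈ R′ → k ∈ R) → Bumps x R′ b
Bumps-resp none     below              _  to-R = λ r∈ → ≮⇒≥ (λ x<r → <⇒≱ x<r (below (to-R x<r r∈)))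
Bumps-resp (bump y) (y∈ , x<y , least) to-R′ to-R = to-R′ x<y y∈ , x<y , λ r∈ x<r → least (to-R x<r r∈) x<r

Bumps-drop : ∀ {x c R₁ R₂ b} → Bumps x R₁ b → b ≢ bump c →
             (∀ {k} → k ∈ R₁ → k ∈ R₂ ⊎ c ≡ k) → (∀ {k} → k ∈ R₂ → k ∈ R₁) → Bumps x R₂ b
Bumps-drop {b = none}   below              _       _  from = below ∘ from
Bumps-drop {b = bump y} (y∈ , x<y , least) c-stays to from with to y∈
... | inj₁ y∈₂ = y∈₂ , x<y , least ∘ from
... | inj₂ refl = contradiction refl c-stays

Bumps-< : ∀ {x R b k} → Bumps x R b → b ≡ bump k → x < k
Bumps-< (_ , x<k , _) refl = x<k

rowInsert-spec : ∀ x R → Increasing R → x ∉ R →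
                 RowInsertion x R (proj₁ (rowInsert x R)) (proj₂ (rowInsert x R))
rowInsert-spec x [] _ _ = record
  { bumps      = λ ()
  ; ∈-row⁻     = λ { (here e) → inj₁ e }
  ; ∈-row⁺     = λ { (inj₁ refl) → here refl ; (inj₂ (() , _)) }
  ; increasing = [] ∷ []
  }
rowInsert-spec x (y ∷ ys) (y<ys ∷ ys↑) x∉ with x <? y
... | yes x<y = record
  { bumps      = here refl , x<y , least
  ; ∈-row⁻     = out
  ; ∈-row⁺     = inn
  ; increasing = All.map (<-trans x<y) y<ys ∷ ys↑
  }
  where
  least : ∀ {r} → r ∈ y ∷ ys → x < r → y ≤ r
  least (here refl) _ = ≤-refl
  least (there r∈)  _ = <⇒≤ (All.lookup y<ys r∈)
  out : ∀ {k} → k ∈ x ∷ ys → k ≡ x ⊎ (k ∈ y ∷ ys × bump y ≢ bump k)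
  out (here refl) = inj₁ refl
  out (there k∈)  = inj₂ (there k∈ , λ { refl → <-irrefl refl (All.lookup y<ys k∈) })
  inn : ∀ {k} → k ≡ x ⊎ (k ∈ y ∷ ys × bump y ≢ bump k) → k ∈ x ∷ ys
  inn (inj₁ refl)             = here refl
  inn (inj₂ (here refl , ≢)) = contradiction refl ≢
  inn (inj₂ (there k∈ , _))  = there k∈
... | no x≮y with rowInsert x ys | rowInsert-spec x ys ys↑ (x∉ ∘ there)
...   | (ys′ , b) | rest = record
  { bumps      = Bumps-∷ y≤x b (bumps rest)
  ; ∈-row⁻     = out
  ; ∈-row⁺     = inn
  ; increasing = All.tabulate y<ys′ ∷ increasing rest
  }
  where
  open RowInsertion
  y≤x : y ≤ x
  y≤x = ≮⇒≥ x≮y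
  y∉bumped : b ≢ bump y
  y∉bumped refl = <-irrefl refl (All.lookup y<ys (proj₁ (bumps rest)))
  out : ∀ {k} → k ∈ y ∷ ys′ → k ≡ x ⊎ (k ∈ y ∷ ys × b ≢ bump k)
  out (here refl) = inj₂ (here refl , y∉bumped)
  out (there k∈) with ∈-row⁻ rest k∈
  ... | inj₁ e          = inj₁ e
  ... | inj₂ (k∈ys , ≢) = inj₂ (there k∈ys , ≢)
  inn : ∀ {k} → k ≡ x ⊎ (k ∈ y ∷ ys × b ≢ bump k) → k ∈ y ∷ ys′
  inn (inj₁ e)                  = there (∈-row⁺ rest (inj₁ e))
  inn (inj₂ (here refl , _))    = here refl
  inn (inj₂ (there k∈ys , ≢))  = there (∈-row⁺ rest (inj₂ (k∈ys , ≢)))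
  y<ys′ : ∀ {k} → k ∈ ys′ → y < k
  y<ys′ k∈ with ∈-row⁻ rest k∈
  ... | inj₁ refl     = ≤∧≢⇒< y≤x (λ { refl → x∉ (here refl) })
  ... | inj₂ (k∈ys , _) = All.lookup y<ys k∈ys

rowInsert-above : ∀ y S → All (_< y) S → rowInsert y S ≡ (S ++ [ y ] , none)
rowInsert-above y []       _           = refl
rowInsert-above y (s ∷ ss) (s<y ∷ ss<y) with y <? s
... | yes y<s = contradiction s<y (<-asym y<s)
... | no _ rewrite rowInsert-above y ss ss<y = refl

-- Two-row tableaux

Row1 : List (List ℕ) → List ℕ
Row1 []      = []
Row1 (R ∷ _) = R

data AtMostTwoRows : List (List ℕ) → Set where
  no-rows  : AtMostTwoRows []
  one-row  : ∀ R → AtMostTwoRows (R ∷ [])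
  two-rows : ∀ R S → AtMostTwoRows (R ∷ S ∷ [])

record TwoRowTableau (u : List ℕ) (T : List (List ℕ)) : Set where
  field
    shape           : AtMostTwoRows T
    row₁-increasing : Increasing (Row1 T)
    row₂-increasing : Increasing (Row2 T)
    row₁⊆u          : ∀ {k} → k ∈ Row1 T → k ∈ u
    row₂⊆u          : ∀ {k} → k ∈ Row2 T → k ∈ u
    rows-disjoint   : ∀ {k} → k ∈ Row1 T → k ∈ Row2 T → ⊥
    -- A later entry x < y would complete the 321-pattern s c x.
    descent         : ∀ {s y} → s ∈ Row2 T → y ∈ Row1 T → y < s →
                      ∃[ c ] (y ≤ c × c < s × (s ∷ c ∷ []) ⊆ u)

record Insertion (x : ℕ) (T T′ : List (List ℕ)) (b : Bump) : Set where
  field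
    bumps-row₁   : Bumps x (Row1 T) b
    ∈-row₁⁻      : ∀ {k} → k ∈ Row1 T′ → k ≡ x ⊎ (k ∈ Row1 T × b ≢ bump k)
    ∈-row₁⁺      : ∀ {k} → k ≡ x ⊎ (k ∈ Row1 T × b ≢ bump k) → k ∈ Row1 T′
    ∈-row₂⁻      : ∀ {k} → k ∈ Row2 T′ → k ∈ Row2 T ⊎ b ≡ bump k
    ∈-row₂⁺      : ∀ {k} → k ∈ Row2 T ⊎ b ≡ bump k → k ∈ Row2 T′
    bumped-above : ∀ {y s} → b ≡ bump y → s ∈ Row2 T → s < y

data Row2Update : List ℕ → Bump → List ℕ → Set where
  unchanged : ∀ {S} → Row2Update S none S
  appended  : ∀ {S y} → Row2Update S (bump y) (S ++ [ y ])

Row2Update-∈⁻ : ∀ {S b S′ k} → Row2Update S b S′ → k ∈ S′ → k ∈ S ⊎ b ≡ bump k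
Row2Update-∈⁻ unchanged          k∈ = inj₁ k∈
Row2Update-∈⁻ (appended {S = S}) k∈ with ∈-++⁻ S k∈
... | inj₁ k∈S        = inj₁ k∈S
... | inj₂ (here refl) = inj₂ refl

Row2Update-∈⁺ : ∀ {S b S′ k} → Row2Update S b S′ → k ∈ S ⊎ b ≡ bump k → k ∈ S′
Row2Update-∈⁺ unchanged          (inj₁ k∈)   = k∈
Row2Update-∈⁺ appended           (inj₁ k∈)   = ∈-++⁺ˡ k∈
Row2Update-∈⁺ (appended {S = S}) (inj₂ refl) = ∈-++⁺ʳ S (here refl)

Row2Update-increasing : ∀ {S b S′} → Row2Update S b S′ → Increasing S →
                        (∀ {y s} → b ≡ bump y → s ∈ S → s < y) → Increasing S′
Row2Update-increasing unchanged S↑ _     = S↑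
Row2Update-increasing appended  S↑ above = AllPairs.++⁺ S↑ ([] ∷ []) (All.tabulate (λ s∈ → above refl s∈ ∷ []))

bumped-above-row₂ : ∀ {u x T y s} → TwoRowTableau u T → FullyCommutative (u ++ [ x ]) →
                    Bumps x (Row1 T) (bump y) → s ∈ Row2 T → s < y
bumped-above-row₂ {s = s} tab fc (y∈ , x<y , _) s∈ with <-cmp s _
... | tri< s<y _ _ = s<y
... | tri≈ _ refl _ = ⊥-elim (TwoRowTableau.rows-disjoint tab y∈ s∈)
... | tri> _ _ y<s with TwoRowTableau.descent tab s∈ y∈ y<s
...   | (c , y≤c , c<s , sc) = contradiction (<-≤-trans x<y y≤c) (≤⇒≯ (FC-descent-≤ fc sc c<s))

insertion-step : ∀ {u x T T′ b} → TwoRowTableau u T → x ∉ u → FullyCommutative (u ++ [ x ]) →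
                 AtMostTwoRows T′ → RowInsertion x (Row1 T) (Row1 T′) b → Row2Update (Row2 T) b (Row2 T′) →
                 TwoRowTableau (u ++ [ x ]) T′ × Σ Bump (Insertion x T T′)
insertion-step {u} {x} {T} {T′} {b} tab x∉u fc shape′ row upd = tab′ , (b , ins)
  where
  open TwoRowTableau tab
  open RowInsertion row

  bumped-above : ∀ {y s} → b ≡ bump y → s ∈ Row2 T → s < y
  bumped-above refl = bumped-above-row₂ tab fc bumps

  ins : Insertion x T T′ b
  ins = record
    { bumps-row₁   = bumps
    ; ∈-row₁⁻      = ∈-row⁻
    ; ∈-row₁⁺      = ∈-row⁺
    ; ∈-row₂⁻      = Row2Update-∈⁻ upd
    ; ∈-row₂⁺      = Row2Update-∈⁺ upd
    ; bumped-above = bumped-above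
    }

  bumped∈u : ∀ {k} → b ≡ bump k → k ∈ u
  bumped∈u refl = row₁⊆u (proj₁ bumps)

  row₂′⊆u : ∀ {k} → k ∈ Row2 T′ → k ∈ u
  row₂′⊆u k∈ with Row2Update-∈⁻ upd k∈
  ... | inj₁ k∈S = row₂⊆u k∈S
  ... | inj₂ hit = bumped∈u hit

  row₁′⊆u : ∀ {k} → k ∈ Row1 T′ → k ∈ u ++ [ x ]
  row₁′⊆u k∈ with ∈-row⁻ k∈
  ... | inj₁ refl       = ∈-++⁺ʳ u (here refl)
  ... | inj₂ (k∈R , _) = ∈-++⁺ˡ (row₁⊆u k∈R)

  disjoint′ : ∀ {k} → k ∈ Row1 T′ → k ∈ Row2 T′ → ⊥
  disjoint′ k∈R′ k∈S′ with ∈-row⁻ k∈R′ | Row2Update-∈⁻ upd k∈S′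
  ... | inj₁ refl          | _          = x∉u (row₂′⊆u k∈S′)
  ... | inj₂ (k∈R , _)     | inj₁ k∈S   = rows-disjoint k∈R k∈S
  ... | inj₂ (_ , unbumped) | inj₂ hit  = unbumped hit

  below-bumped : ∀ {r y} → b ≡ bump y → r ∈ Row1 T → r < y → r ≤ x
  below-bumped refl r∈ r<y = ≮⇒≥ (λ x<r → <⇒≱ r<y (proj₂ (proj₂ bumps) r∈ x<r))

  x-after : ∀ {s} → s ∈ Row2 T′ → (s ∷ x ∷ []) ⊆ u ++ [ x ]
  x-after s∈ = ++⁺ (from∈ (row₂′⊆u s∈)) ⊆-refl

  descent′ : ∀ {s r} → s ∈ Row2 T′ → r ∈ Row1 T′ → r < s →
             ∃[ c ] (r ≤ c × c < s × (s ∷ c ∷ []) ⊆ u ++ [ x ])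
  descent′ s∈ r∈ r<s with ∈-row⁻ r∈ | Row2Update-∈⁻ upd s∈
  ... | inj₁ refl      | _        = x , ≤-refl , r<s , x-after s∈
  ... | inj₂ (r∈R , _) | inj₁ s∈S with descent s∈S r∈R r<s
  ...   | (c , r≤c , c<s , sc) = c , r≤c , c<s , ++⁺ʳ [ x ] sc
  descent′ s∈ r∈ r<s | inj₂ (r∈R , _) | inj₂ hit =
    x , below-bumped hit r∈R r<s , bumped-above-x hit , x-after s∈
    where
    bumped-above-x : ∀ {y} → b ≡ bump y → x < y
    bumped-above-x refl = proj₁ (proj₂ bumps)

  tab′ : TwoRowTableau (u ++ [ x ]) T′
  tab′ = record
    { shape           = shape′
    ; row₁-increasing = increasing
    ; row₂-increasing = Row2Update-increasing upd row₂-increasing bumped-above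
    ; row₁⊆u          = row₁′⊆u
    ; row₂⊆u          = ∈-++⁺ˡ ∘ row₂′⊆u
    ; rows-disjoint   = disjoint′
    ; descent         = descent′
    }

insert-by-shape : ∀ {u T} x → AtMostTwoRows T → TwoRowTableau u T → x ∉ u → FullyCommutative (u ++ [ x ]) →
                  TwoRowTableau (u ++ [ x ]) (tabInsert x T) × Σ Bump (Insertion x T (tabInsert x T))
insert-by-shape x no-rows tab x∉u fc =
  insertion-step tab x∉u fc (one-row _) (rowInsert-spec x [] [] λ ()) unchanged
insert-by-shape x (one-row R) tab x∉u fc
  with rowInsert x R | rowInsert-spec x R (TwoRowTableau.row₁-increasing tab) (x∉u ∘ TwoRowTableau.row₁⊆u tab)
... | (R′ , none)   | row = insertion-step tab x∉u fc (one-row R′) row unchanged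
... | (R′ , bump y) | row = insertion-step tab x∉u fc (two-rows R′ _) row appended
insert-by-shape x (two-rows R S) tab x∉u fc
  with rowInsert x R | rowInsert-spec x R (TwoRowTableau.row₁-increasing tab) (x∉u ∘ TwoRowTableau.row₁⊆u tab)
... | (R′ , none)   | row = insertion-step tab x∉u fc (two-rows R′ S) row unchanged
... | (R′ , bump y) | row
  rewrite rowInsert-above y S (All.tabulate (bumped-above-row₂ tab fc (RowInsertion.bumps row)))
  = insertion-step tab x∉u fc (two-rows R′ _) row appended

tabInsert-spec : ∀ {u T} x → TwoRowTableau u T → x ∉ u → FullyCommutative (u ++ [ x ]) →
                 TwoRowTableau (u ++ [ x ]) (tabInsert x T) × Σ Bump (Insertion x T (tabInsert x T))
tabInsert-spec x tab = insert-by-shape x (TwoRowTableau.shape tab) tab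

-- Comparing two insertion sequences

rebump : ∀ {x T T′ b b′} → Insertion x T T′ b → Bumps x (Row1 T) b′ → Insertion x T T′ b′
rebump {x} {T} {T′} {b} {b′} ins bumps′ =
  subst (Insertion x T T′) (Bumps-functional b b′ (Insertion.bumps-row₁ ins) bumps′) ins

data Shift (T₁ T₂ : List (List ℕ)) : Set where
  aligned : (_∈ Row1 T₁) ≐ (_∈ Row1 T₂) → (_∈ Row2 T₁) ≐ (_∈ Row2 T₂) → Shift T₁ T₂
  shifted : ∀ c → c ∉ Row1 T₂ →
            (_∈ Row1 T₁) ≐ (_∈ Row1 T₂) ∪ ｛ c ｝ →
            (_∈ Row2 T₂) ≐ (_∈ Row2 T₁) ∪ ｛ c ｝ → Shift T₁ T₂

Shift-row₂⊆ : ∀ {T₁ T₂ k} → Shift T₁ T₂ → k ∈ Row2 T₁ → k ∈ Row2 T₂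
Shift-row₂⊆ (aligned _ (to , _))        k∈ = to k∈
Shift-row₂⊆ (shifted _ _ _ (_ , from)) k∈ = from (inj₁ k∈)

module _ {x : ℕ} {T₁ T₂ T₁′ T₂′ : List (List ℕ)} where
  open Insertion

  insertion-mono₁ : ∀ {b} → Insertion x T₁ T₁′ b → Insertion x T₂ T₂′ b →
                    (∀ {k} → k ∈ Row1 T₁ → k ∈ Row1 T₂) → ∀ {k} → k ∈ Row1 T₁′ → k ∈ Row1 T₂′
  insertion-mono₁ i₁ i₂ ⊆₁ k∈ with ∈-row₁⁻ i₁ k∈
  ... | inj₁ k≡x             = ∈-row₁⁺ i₂ (inj₁ k≡x)
  ... | inj₂ (k∈ , unbumped) = ∈-row₁⁺ i₂ (inj₂ (⊆₁ k∈ , unbumped))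

  insertion-mono₂ : ∀ {b} → Insertion x T₁ T₁′ b → Insertion x T₂ T₂′ b →
                    (∀ {k} → k ∈ Row2 T₁ → k ∈ Row2 T₂) → ∀ {k} → k ∈ Row2 T₁′ → k ∈ Row2 T₂′
  insertion-mono₂ i₁ i₂ ⊆₂ k∈ with ∈-row₂⁻ i₁ k∈
  ... | inj₁ k∈S = ∈-row₂⁺ i₂ (inj₁ (⊆₂ k∈S))
  ... | inj₂ hit = ∈-row₂⁺ i₂ (inj₂ hit)

Shift-insert-aligned : ∀ {x T₁ T₂ T₁′ T₂′ b} →
                       (_∈ Row1 T₁) ≐ (_∈ Row1 T₂) → (_∈ Row2 T₁) ≐ (_∈ Row2 T₂) →
                       Insertion x T₁ T₁′ b → Insertion x T₂ T₂′ b → Shift T₁′ T₂′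
Shift-insert-aligned (to₁ , from₁) (to₂ , from₂) i₁ i₂ =
  aligned (insertion-mono₁ i₁ i₂ to₁ , insertion-mono₁ i₂ i₁ from₁)
          (insertion-mono₂ i₁ i₂ to₂ , insertion-mono₂ i₂ i₁ from₂)

Shift-insert-shifted : ∀ {x c T₁ T₂ T₁′ T₂′ b₁ b₂} → c ∉ Row1 T₂ →
                       (_∈ Row1 T₁) ≐ (_∈ Row1 T₂) ∪ ｛ c ｝ →
                       (_∈ Row2 T₂) ≐ (_∈ Row2 T₁) ∪ ｛ c ｝ →
                       x ∉ Row1 T₁ → b₁ ≢ bump c →
                       Insertion x T₁ T₁′ b₁ → Insertion x T₂ T₂′ b₂ → Shift T₁′ T₂′
Shift-insert-shifted {x} {c} {T₁} {T₂} {T₁′} {T₂′} {b₁} c∉ (to₁ , from₁) (to₂ , from₂) x∉ c-stays i₁ i₂ =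
  shifted c c∉′ (row₁-to , row₁-from) (row₂-to , row₂-from)
  where
  open Insertion
  i₂′ : Insertion x T₂ T₂′ b₁
  i₂′ = rebump i₂ (Bumps-drop (bumps-row₁ i₁) c-stays to₁ (from₁ ∘ inj₁))

  c∉′ : c ∉ Row1 T₂′
  c∉′ c∈ with ∈-row₁⁻ i₂′ c∈
  ... | inj₁ refl      = x∉ (from₁ (inj₂ refl))
  ... | inj₂ (c∈₂ , _) = c∉ c∈₂

  row₁-to : ∀ {k} → k ∈ Row1 T₁′ → k ∈ Row1 T₂′ ⊎ c ≡ k
  row₁-to k∈ with ∈-row₁⁻ i₁ k∈
  ... | inj₁ k≡x         = inj₁ (∈-row₁⁺ i₂′ (inj₁ k≡x))
  ... | inj₂ (k∈₁ , unb) with to₁ k∈₁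
  ...   | inj₁ k∈₂ = inj₁ (∈-row₁⁺ i₂′ (inj₂ (k∈₂ , unb)))
  ...   | inj₂ c≡k = inj₂ c≡k

  row₁-from : ∀ {k} → k ∈ Row1 T₂′ ⊎ c ≡ k → k ∈ Row1 T₁′
  row₁-from (inj₂ refl) = ∈-row₁⁺ i₁ (inj₂ (from₁ (inj₂ refl) , c-stays))
  row₁-from (inj₁ k∈) with ∈-row₁⁻ i₂′ k∈
  ... | inj₁ k≡x         = ∈-row₁⁺ i₁ (inj₁ k≡x)
  ... | inj₂ (k∈₂ , unb) = ∈-row₁⁺ i₁ (inj₂ (from₁ (inj₁ k∈₂) , unb))

  row₂-to : ∀ {k} → k ∈ Row2 T₂′ → k ∈ Row2 T₁′ ⊎ c ≡ k
  row₂-to k∈ with ∈-row₂⁻ i₂′ k∈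
  ... | inj₂ hit = inj₁ (∈-row₂⁺ i₁ (inj₂ hit))
  ... | inj₁ k∈₂ with to₂ k∈₂
  ...   | inj₁ k∈₁ = inj₁ (∈-row₂⁺ i₁ (inj₁ k∈₁))
  ...   | inj₂ c≡k = inj₂ c≡k

  row₂-from : ∀ {k} → k ∈ Row2 T₁′ ⊎ c ≡ k → k ∈ Row2 T₂′
  row₂-from (inj₂ c≡k) = ∈-row₂⁺ i₂′ (inj₁ (from₂ (inj₂ c≡k)))
  row₂-from (inj₁ k∈) with ∈-row₂⁻ i₁ k∈
  ... | inj₁ k∈₁ = ∈-row₂⁺ i₂′ (inj₁ (from₂ (inj₁ k∈₁)))
  ... | inj₂ hit = ∈-row₂⁺ i₂′ (inj₂ hit)

Shift-insert-settles : ∀ {x c T₁ T₂ T₁′ T₂′} → c ∉ Row1 T₂ →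
                       (_∈ Row1 T₁) ≐ (_∈ Row1 T₂) ∪ ｛ c ｝ →
                       (_∈ Row2 T₂) ≐ (_∈ Row2 T₁) ∪ ｛ c ｝ →
                       Insertion x T₁ T₁′ (bump c) → Insertion x T₂ T₂′ none → Shift T₁′ T₂′
Shift-insert-settles {x} {c} {T₁} {T₂} {T₁′} {T₂′} c∉ (to₁ , from₁) (to₂ , from₂) i₁ i₂ =
  aligned (row₁-to , row₁-from) (row₂-to , row₂-from)
  where
  open Insertion
  row₁-to : ∀ {k} → k ∈ Row1 T₁′ → k ∈ Row1 T₂′
  row₁-to k∈ with ∈-row₁⁻ i₁ k∈
  ... | inj₁ k≡x         = ∈-row₁⁺ i₂ (inj₁ k≡x)
  ... | inj₂ (k∈₁ , unb) with to₁ k∈₁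
  ...   | inj₁ k∈₂  = ∈-row₁⁺ i₂ (inj₂ (k∈₂ , λ ()))
  ...   | inj₂ refl = contradiction refl unb

  row₁-from : ∀ {k} → k ∈ Row1 T₂′ → k ∈ Row1 T₁′
  row₁-from k∈ with ∈-row₁⁻ i₂ k∈
  ... | inj₁ k≡x       = ∈-row₁⁺ i₁ (inj₁ k≡x)
  ... | inj₂ (k∈₂ , _) = ∈-row₁⁺ i₁ (inj₂ (from₁ (inj₁ k∈₂) , λ { refl → c∉ k∈₂ }))

  row₂-to : ∀ {k} → k ∈ Row2 T₁′ → k ∈ Row2 T₂′
  row₂-to k∈ with ∈-row₂⁻ i₁ k∈
  ... | inj₁ k∈₁ = ∈-row₂⁺ i₂ (inj₁ (from₂ (inj₁ k∈₁)))
  ... | inj₂ refl = ∈-row₂⁺ i₂ (inj₁ (from₂ (inj₂ refl)))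

  row₂-from : ∀ {k} → k ∈ Row2 T₂′ → k ∈ Row2 T₁′
  row₂-from k∈ with ∈-row₂⁻ i₂ k∈
  ... | inj₂ ()
  ... | inj₁ k∈₂ with to₂ k∈₂
  ...   | inj₁ k∈₁  = ∈-row₂⁺ i₁ (inj₁ k∈₁)
  ...   | inj₂ refl = ∈-row₂⁺ i₁ (inj₂ refl)

Shift-insert-passes : ∀ {x c d T₁ T₂ T₁′ T₂′} → c ∉ Row1 T₂ →
                      (_∈ Row1 T₁) ≐ (_∈ Row1 T₂) ∪ ｛ c ｝ →
                      (_∈ Row2 T₂) ≐ (_∈ Row2 T₁) ∪ ｛ c ｝ →
                      Insertion x T₁ T₁′ (bump c) → Insertion x T₂ T₂′ (bump d) → Shift T₁′ T₂′
Shift-insert-passes {x} {c} {d} {T₁} {T₂} {T₁′} {T₂′} c∉ (to₁ , from₁) (to₂ , from₂) i₁ i₂ =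
  shifted d d∉′ (row₁-to , row₁-from) (row₂-to , row₂-from)
  where
  open Insertion
  d∈₂ : d ∈ Row1 T₂
  d∈₂ = proj₁ (bumps-row₁ i₂)

  d∉′ : d ∉ Row1 T₂′
  d∉′ d∈ with ∈-row₁⁻ i₂ d∈
  ... | inj₁ refl    = <-irrefl refl (proj₁ (proj₂ (bumps-row₁ i₂)))
  ... | inj₂ (_ , unb) = unb refl

  row₁-to : ∀ {k} → k ∈ Row1 T₁′ → k ∈ Row1 T₂′ ⊎ d ≡ k
  row₁-to k∈ with ∈-row₁⁻ i₁ k∈
  ... | inj₁ k≡x         = inj₁ (∈-row₁⁺ i₂ (inj₁ k≡x))
  ... | inj₂ (k∈₁ , unb) with to₁ k∈₁
  ...   | inj₂ refl = contradiction refl unb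
  ...   | inj₁ k∈₂ with d ≟ _
  ...     | yes d≡k = inj₂ d≡k
  ...     | no d≢k  = inj₁ (∈-row₁⁺ i₂ (inj₂ (k∈₂ , λ { refl → d≢k refl })))

  row₁-from : ∀ {k} → k ∈ Row1 T₂′ ⊎ d ≡ k → k ∈ Row1 T₁′
  row₁-from (inj₂ refl) = ∈-row₁⁺ i₁ (inj₂ (from₁ (inj₁ d∈₂) , λ { refl → c∉ d∈₂ }))
  row₁-from (inj₁ k∈) with ∈-row₁⁻ i₂ k∈
  ... | inj₁ k≡x       = ∈-row₁⁺ i₁ (inj₁ k≡x)
  ... | inj₂ (k∈₂ , _) = ∈-row₁⁺ i₁ (inj₂ (from₁ (inj₁ k∈₂) , λ { refl → c∉ k∈₂ }))

  row₂-to : ∀ {k} → k ∈ Row2 T₂′ → k ∈ Row2 T₁′ ⊎ d ≡ k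
  row₂-to k∈ with ∈-row₂⁻ i₂ k∈
  ... | inj₂ refl = inj₂ refl
  ... | inj₁ k∈₂ with to₂ k∈₂
  ...   | inj₁ k∈₁  = inj₁ (∈-row₂⁺ i₁ (inj₁ k∈₁))
  ...   | inj₂ refl = inj₁ (∈-row₂⁺ i₁ (inj₂ refl))

  row₂-from : ∀ {k} → k ∈ Row2 T₁′ ⊎ d ≡ k → k ∈ Row2 T₂′
  row₂-from (inj₂ refl) = ∈-row₂⁺ i₂ (inj₂ refl)
  row₂-from (inj₁ k∈) with ∈-row₂⁻ i₁ k∈
  ... | inj₁ k∈₁  = ∈-row₂⁺ i₂ (inj₁ (from₂ (inj₁ k∈₁)))
  ... | inj₂ refl = ∈-row₂⁺ i₂ (inj₁ (from₂ (inj₂ refl)))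

Shift-insert : ∀ {x T₁ T₂ T₁′ T₂′ b₁ b₂} → Shift T₁ T₂ → x ∉ Row1 T₁ →
               Insertion x T₁ T₁′ b₁ → Insertion x T₂ T₂′ b₂ → Shift T₁′ T₂′
Shift-insert {b₁ = b₁} (aligned r₁@(to₁ , from₁) r₂) _ i₁ i₂ =
  Shift-insert-aligned r₁ r₂ i₁
    (rebump i₂ (Bumps-resp b₁ (Insertion.bumps-row₁ i₁) (λ _ → to₁) (λ _ → from₁)))
Shift-insert {b₁ = none} (shifted c c∉ r₁ r₂) x∉ i₁ i₂ = Shift-insert-shifted c∉ r₁ r₂ x∉ (λ ()) i₁ i₂
Shift-insert {b₁ = bump y} {b₂} (shifted c c∉ r₁ r₂) x∉ i₁ i₂ with y ≟ c | b₂
... | no y≢c   | _      = Shift-insert-shifted c∉ r₁ r₂ x∉ (λ { refl → y≢c refl }) i₁ i₂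
... | yes refl | none   = Shift-insert-settles c∉ r₁ r₂ i₁ i₂
... | yes refl | bump d = Shift-insert-passes c∉ r₁ r₂ i₁ i₂

module _ {a b : ℕ} {T Ta Tab Tb Tba : List (List ℕ)} {β γ : Bump} where
  open Insertion

  insertions-commute₁ : Insertion a T Ta β → Insertion b Ta Tab γ → Insertion b T Tb γ → Insertion a Tb Tba β →
                        β ≢ bump b → ∀ {k} → k ∈ Row1 Tab → k ∈ Row1 Tba
  insertions-commute₁ ia iab ib iba b-stays k∈ with ∈-row₁⁻ iab k∈
  ... | inj₁ refl         = ∈-row₁⁺ iba (inj₂ (∈-row₁⁺ ib (inj₁ refl) , b-stays))
  ... | inj₂ (k∈a , unbγ) with ∈-row₁⁻ ia k∈a
  ...   | inj₁ k≡a         = ∈-row₁⁺ iba (inj₁ k≡a)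
  ...   | inj₂ (k∈ , unbβ) = ∈-row₁⁺ iba (inj₂ (∈-row₁⁺ ib (inj₂ (k∈ , unbγ)) , unbβ))

  insertions-commute₂ : Insertion a T Ta β → Insertion b Ta Tab γ → Insertion b T Tb γ → Insertion a Tb Tba β →
                        ∀ {k} → k ∈ Row2 Tab → k ∈ Row2 Tba
  insertions-commute₂ ia iab ib iba k∈ with ∈-row₂⁻ iab k∈
  ... | inj₂ hitγ = ∈-row₂⁺ iba (inj₁ (∈-row₂⁺ ib (inj₂ hitγ)))
  ... | inj₁ k∈a with ∈-row₂⁻ ia k∈a
  ...   | inj₁ k∈  = ∈-row₂⁺ iba (inj₁ (∈-row₂⁺ ib (inj₁ k∈)))
  ...   | inj₂ hitβ = ∈-row₂⁺ iba (inj₂ hitβ)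

Shift-swap-bumped : ∀ {a b y T Ta Tab Tb Tba γ δ ε} → a < b → y < b →
                    Insertion a T Ta (bump y) → Insertion b Ta Tab γ → Insertion b T Tb δ → Insertion a Tb Tba ε →
                    Shift Tab Tba
Shift-swap-bumped {a} {b} {y} {T} {Ta} {Tab} {Tb} {Tba} {δ = δ} a<b y<b ia iab ib iba =
  aligned (insertions-commute₁ ia iab′ ib iba′ (λ { refl → <-irrefl refl y<b })
          , insertions-commute₁ ib iba′ ia iab′ (λ δ≡a → <-asym a<b (Bumps-< (bumps-row₁ ib) δ≡a)))
          (insertions-commute₂ ia iab′ ib iba′ , insertions-commute₂ ib iba′ ia iab′)
  where
  open Insertion
  y∈ = proj₁ (bumps-row₁ ia)
  a<y = proj₁ (proj₂ (bumps-row₁ ia))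
  least = proj₂ (proj₂ (bumps-row₁ ia))

  above-b-kept : ∀ {k} → b < k → k ∈ Row1 T → k ∈ Row1 Ta
  above-b-kept b<k k∈ = ∈-row₁⁺ ia (inj₂ (k∈ , λ { refl → <-asym y<b b<k }))

  above-b-old : ∀ {k} → b < k → k ∈ Row1 Ta → k ∈ Row1 T
  above-b-old b<k k∈ with ∈-row₁⁻ ia k∈
  ... | inj₁ refl     = contradiction a<b (<-asym b<k)
  ... | inj₂ (k∈ , _) = k∈

  iab′ : Insertion b Ta Tab δ
  iab′ = rebump iab (Bumps-resp δ (bumps-row₁ ib) above-b-kept above-b-old)

  least′ : ∀ {r} → r ∈ Row1 Tb → a < r → y ≤ r
  least′ r∈ a<r with ∈-row₁⁻ ib r∈
  ... | inj₁ refl     = <⇒≤ y<b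
  ... | inj₂ (r∈ , _) = least r∈ a<r

  y∈Tb : y ∈ Row1 Tb
  y∈Tb = ∈-row₁⁺ ib (inj₂ (y∈ , λ δ≡y → <-asym y<b (Bumps-< (bumps-row₁ ib) δ≡y)))

  iba′ : Insertion a Tb Tba (bump y)
  iba′ = rebump iba (y∈Tb , a<y , least′)

Shift-swap-unbumped : ∀ {a b T Ta Tab Tb Tba γ δ ε} → a < b → b ∉ Row1 T →
                      Insertion a T Ta none → Insertion b Ta Tab γ → Insertion b T Tb δ → Insertion a Tb Tba ε →
                      Shift Tab Tba
Shift-swap-unbumped {a} {b} {T} {Ta} {Tab} {Tb} {Tba} a<b b∉ ia iab ib iba =
  shifted b b∉′ (row₁-to , row₁-from) (row₂-to , row₂-from)
  where
  open Insertion
  ib′ : Insertion b T Tb none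
  ib′ = rebump ib (λ r∈ → ≤-trans (bumps-row₁ ia r∈) (<⇒≤ a<b))

  Ta≤b : ∀ {r} → r ∈ Row1 Ta → r ≤ b
  Ta≤b r∈ with ∈-row₁⁻ ia r∈
  ... | inj₁ refl     = <⇒≤ a<b
  ... | inj₂ (r∈ , _) = ≤-trans (bumps-row₁ ia r∈) (<⇒≤ a<b)

  iab′ : Insertion b Ta Tab none
  iab′ = rebump iab Ta≤b

  least : ∀ {r} → r ∈ Row1 Tb → a < r → b ≤ r
  least r∈ a<r with ∈-row₁⁻ ib′ r∈
  ... | inj₁ refl     = ≤-refl
  ... | inj₂ (r∈ , _) = contradiction (bumps-row₁ ia r∈) (<⇒≱ a<r)

  iba′ : Insertion a Tb Tba (bump b)
  iba′ = rebump iba (∈-row₁⁺ ib′ (inj₁ refl) , a<b , least)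

  b∉′ : b ∉ Row1 Tba
  b∉′ b∈ with ∈-row₁⁻ iba′ b∈
  ... | inj₁ refl      = <-irrefl refl a<b
  ... | inj₂ (_ , unb) = unb refl

  row₁-to : ∀ {k} → k ∈ Row1 Tab → k ∈ Row1 Tba ⊎ b ≡ k
  row₁-to k∈ with ∈-row₁⁻ iab′ k∈
  ... | inj₁ refl      = inj₂ refl
  ... | inj₂ (k∈a , _) with ∈-row₁⁻ ia k∈a
  ...   | inj₁ k≡a      = inj₁ (∈-row₁⁺ iba′ (inj₁ k≡a))
  ...   | inj₂ (k∈ , _) = inj₁ (∈-row₁⁺ iba′ (inj₂ (∈-row₁⁺ ib′ (inj₂ (k∈ , λ ()))
                                                 , λ { refl → b∉ k∈ })))

  row₁-from : ∀ {k} → k ∈ Row1 Tba ⊎ b ≡ k → k ∈ Row1 Tab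
  row₁-from (inj₂ refl) = ∈-row₁⁺ iab′ (inj₁ refl)
  row₁-from (inj₁ k∈) with ∈-row₁⁻ iba′ k∈
  ... | inj₁ k≡a           = ∈-row₁⁺ iab′ (inj₂ (∈-row₁⁺ ia (inj₁ k≡a) , λ ()))
  ... | inj₂ (k∈b , unb) with ∈-row₁⁻ ib′ k∈b
  ...   | inj₁ refl      = contradiction refl unb
  ...   | inj₂ (k∈ , _) = ∈-row₁⁺ iab′ (inj₂ (∈-row₁⁺ ia (inj₂ (k∈ , λ ())) , λ ()))

  row₂-to : ∀ {k} → k ∈ Row2 Tba → k ∈ Row2 Tab ⊎ b ≡ k
  row₂-to k∈ with ∈-row₂⁻ iba′ k∈
  ... | inj₂ refl = inj₂ refl
  ... | inj₁ k∈b with ∈-row₂⁻ ib′ k∈b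
  ...   | inj₂ ()
  ...   | inj₁ k∈ = inj₁ (∈-row₂⁺ iab′ (inj₁ (∈-row₂⁺ ia (inj₁ k∈))))

  row₂-from : ∀ {k} → k ∈ Row2 Tab ⊎ b ≡ k → k ∈ Row2 Tba
  row₂-from (inj₂ refl) = ∈-row₂⁺ iba′ (inj₂ refl)
  row₂-from (inj₁ k∈) with ∈-row₂⁻ iab′ k∈
  ... | inj₂ ()
  ... | inj₁ k∈a with ∈-row₂⁻ ia k∈a
  ...   | inj₂ ()
  ...   | inj₁ k∈ = ∈-row₂⁺ iba′ (inj₁ (∈-row₂⁺ ib′ (inj₁ k∈)))

-- If y > b, then y b a would be a 321-pattern: a bumps b, which lies below y in row 2.
bumped-before-swap-< : ∀ {a b y T Tb Tba δ ε} → a < b → b ∉ Row1 T → Bumps a (Row1 T) (bump y) →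
                       Insertion b T Tb δ → Insertion a Tb Tba ε → y < b
bumped-before-swap-< {a} {b} {y} {T} {Tb} {Tba} a<b b∉ (y∈ , a<y , least) ib iba with <-cmp y b
... | tri< y<b _ _  = y<b
... | tri≈ _ refl _ = contradiction y∈ b∉
... | tri> _ _ b<y  =
  contradiction (Insertion.bumped-above iba′ refl (Insertion.∈-row₂⁺ ib′ (inj₂ refl))) (<-asym b<y)
  where
  ib′ : Insertion b T Tb (bump y)
  ib′ = rebump ib (y∈ , b<y , λ r∈ b<r → least r∈ (<-trans a<b b<r))

  least′ : ∀ {r} → r ∈ Row1 Tb → a < r → b ≤ r
  least′ r∈ a<r with Insertion.∈-row₁⁻ ib′ r∈
  ... | inj₁ refl     = ≤-refl
  ... | inj₂ (r∈ , _) = <⇒≤ (<-≤-trans b<y (least r∈ a<r))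

  iba′ : Insertion a Tb Tba (bump b)
  iba′ = rebump iba (Insertion.∈-row₁⁺ ib′ (inj₁ refl) , a<b , least′)

Shift-swap : ∀ {a b T Ta Tab Tb Tba β γ δ ε} → a < b → b ∉ Row1 T →
             Insertion a T Ta β → Insertion b Ta Tab γ → Insertion b T Tb δ → Insertion a Tb Tba ε →
             Shift Tab Tba
Shift-swap {β = none}   a<b b∉ ia iab ib iba = Shift-swap-unbumped a<b b∉ ia iab ib iba
Shift-swap {β = bump y} a<b b∉ ia iab ib iba =
  Shift-swap-bumped a<b (bumped-before-swap-< a<b b∉ (Insertion.bumps-row₁ ia) ib iba) ia iab ib iba

-- Insertion tableaux of 321-avoiding words

DistinctFC : List ℕ → Set
DistinctFC w = Unique w × FullyCommutative w

DistinctFC-++⁻ˡ : ∀ {v} t → DistinctFC (v ++ t) → DistinctFC v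
DistinctFC-++⁻ˡ t (un , fc) = Unique-++⁻ˡ t un , FC-++⁻ˡ t fc

P-∷ʳ : ∀ v x → P (v ++ [ x ]) ≡ tabInsert x (P v)
P-∷ʳ v x = foldl-++ (λ T y → tabInsert y T) [] v [ x ]

empty-tableau : TwoRowTableau [] []
empty-tableau = record
  { shape           = no-rows
  ; row₁-increasing = []
  ; row₂-increasing = []
  ; row₁⊆u          = λ ()
  ; row₂⊆u          = λ ()
  ; rows-disjoint   = λ ()
  ; descent         = λ ()
  }

P-tableau : ∀ w → DistinctFC w → TwoRowTableau w (P w)
P-tableau w = go (reverseView w)
  where
  go : ∀ {w} → Reverse w → DistinctFC w → TwoRowTableau w (P w)
  go []           _           = empty-tableau
  go (v ∶ r ∶ʳ x) ok@(un , fc) rewrite P-∷ʳ v x =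
    proj₁ (tabInsert-spec x (go r (DistinctFC-++⁻ˡ [ x ] ok)) (Unique-∷ʳ⇒∉ un) fc)

insertion-∷ʳ : ∀ v x → DistinctFC (v ++ [ x ]) → Σ Bump (Insertion x (P v) (P (v ++ [ x ])))
insertion-∷ʳ v x ok@(un , fc) rewrite P-∷ʳ v x =
  proj₂ (tabInsert-spec x (P-tableau v (DistinctFC-++⁻ˡ [ x ] ok)) (Unique-∷ʳ⇒∉ un) fc)

Shift-++ : ∀ {v₁ v₂} t → Shift (P v₁) (P v₂) → DistinctFC (v₁ ++ t) → DistinctFC (v₂ ++ t) →
           Shift (P (v₁ ++ t)) (P (v₂ ++ t))
Shift-++ {v₁} {v₂} t shift = go (reverseView t)
  where
  go : ∀ {t} → Reverse t → DistinctFC (v₁ ++ t) → DistinctFC (v₂ ++ t) → Shift (P (v₁ ++ t)) (P (v₂ ++ t))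
  go [] _ _ rewrite ++-identityʳ v₁ | ++-identityʳ v₂ = shift
  go (t ∶ r ∶ʳ x) ok₁ ok₂ rewrite sym (++-assoc v₁ t [ x ]) | sym (++-assoc v₂ t [ x ]) =
    Shift-insert (go r (DistinctFC-++⁻ˡ [ x ] ok₁) (DistinctFC-++⁻ˡ [ x ] ok₂)) x∉
                 (proj₂ (insertion-∷ʳ _ x ok₁)) (proj₂ (insertion-∷ʳ _ x ok₂))
    where
    x∉ : x ∉ Row1 (P (v₁ ++ t))
    x∉ = Unique-∷ʳ⇒∉ (proj₁ ok₁) ∘ TwoRowTableau.row₁⊆u (P-tableau _ (DistinctFC-++⁻ˡ [ x ] ok₁))

Shift-swap-∷ʳ : ∀ u {a b} → a < b → DistinctFC ((u ++ [ a ]) ++ [ b ]) → DistinctFC ((u ++ [ b ]) ++ [ a ]) →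
                Shift (P ((u ++ [ a ]) ++ [ b ])) (P ((u ++ [ b ]) ++ [ a ]))
Shift-swap-∷ʳ u {a} {b} a<b ok₁ ok₂ =
  Shift-swap a<b b∉
    (proj₂ (insertion-∷ʳ u a (DistinctFC-++⁻ˡ [ b ] ok₁))) (proj₂ (insertion-∷ʳ (u ++ [ a ]) b ok₁))
    (proj₂ (insertion-∷ʳ u b (DistinctFC-++⁻ˡ [ a ] ok₂))) (proj₂ (insertion-∷ʳ (u ++ [ b ]) a ok₂))
  where
  ub-ok = DistinctFC-++⁻ˡ [ a ] ok₂
  b∉ : b ∉ Row1 (P u)
  b∉ = Unique-∷ʳ⇒∉ (proj₁ ub-ok) ∘ TwoRowTableau.row₁⊆u (P-tableau u (DistinctFC-++⁻ˡ [ b ] ub-ok))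

++-∷ʳ-∷ʳ : ∀ u (x y : ℕ) t → ((u ++ [ x ]) ++ [ y ]) ++ t ≡ u ++ x ∷ y ∷ t
++-∷ʳ-∷ʳ u x y t = trans (++-assoc (u ++ [ x ]) [ y ] t) (++-assoc u [ x ] (y ∷ t))

row₂-swap-⊆ : ∀ u {a b} t → a < b → DistinctFC (u ++ a ∷ b ∷ t) → DistinctFC (u ++ b ∷ a ∷ t) →
              ∀ {k} → k ∈ Row2 (P (u ++ a ∷ b ∷ t)) → k ∈ Row2 (P (u ++ b ∷ a ∷ t))
row₂-swap-⊆ u {a} {b} t a<b ok₁ ok₂ rewrite sym (++-∷ʳ-∷ʳ u a b t) | sym (++-∷ʳ-∷ʳ u b a t) =
  Shift-row₂⊆ (Shift-++ t (Shift-swap-∷ʳ u a<b (DistinctFC-++⁻ˡ t ok₁) (DistinctFC-++⁻ˡ t ok₂)) ok₁ ok₂)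

-- The right weak order

data AscentSwap : List ℕ → List ℕ → Set where
  ascent-swap : ∀ u {a b} t → a < b → AscentSwap (u ++ a ∷ b ∷ t) (u ++ b ∷ a ∷ t)

swapAt-decompose : ∀ i w → suc i < length w →
                   ∃[ u ] ∃[ a ] ∃[ b ] ∃[ t ] (w ≡ u ++ a ∷ b ∷ t × swapAt i w ≡ u ++ b ∷ a ∷ t)
swapAt-decompose zero    (a ∷ b ∷ t) _           = [] , a , b , t , refl , refl
swapAt-decompose zero    (a ∷ [])    (s≤s ())
swapAt-decompose (suc i) (x ∷ w)     (s≤s i<len) with swapAt-decompose i w i<len
... | u , a , b , t , w≡ , w′≡ = x ∷ u , a , b , t , cong (x ∷_) w≡ , cong (x ∷_) w′≡

count< : ℕ → List ℕ → ℕ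
count< x xs = length (filter (_<? x) xs)

count<-∷ : ∀ x y t → count< x t ≤ count< x (y ∷ t)
count<-∷ x y t = length-mono-≤ (filter⁺ (_<? x) (_<? x) (λ { refl → id }) (y ∷ʳ ⊆-refl))

inv-swap-≤ : ∀ u {a b : ℕ} t → b ≤ a → inv (u ++ b ∷ a ∷ t) ≤ inv (u ++ a ∷ b ∷ t)
inv-swap-≤ (y ∷ u) {a} {b} t b≤a =
  +-mono-≤ (≤-reflexive (↭-length (filter-↭ (_<? y) (++⁺ˡ u (swap b a refl))))) (inv-swap-≤ u t b≤a)
inv-swap-≤ [] {a} {b} t b≤a = begin
  count< b (a ∷ t) + (count< a t + inv t) ≡⟨ cong (_+ _) (cong length (filter-reject (_<? b) (≤⇒≯ b≤a))) ⟩
  count< b t + (count< a t + inv t)       ≡⟨ x∙yz≈y∙xz (count< b t) (count< a t) (inv t) ⟩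
  count< a t + (count< b t + inv t)       ≤⟨ +-monoˡ-≤ _ (count<-∷ a b t) ⟩
  count< a (b ∷ t) + (count< b t + inv t) ∎
  where open ≤-Reasoning

WeakStep⇒AscentSwap : ∀ {w v} → WeakStep w v → AscentSwap w v
WeakStep⇒AscentSwap (step {w} i i<len inv<) with swapAt-decompose i w i<len
... | u , a , b , t , w≡ , w′≡ =
  subst₂ AscentSwap (sym w≡) (sym w′≡) (ascent-swap u t (≰⇒> b≮a))
  where
  b≮a : ¬ (b ≤ a)
  b≮a b≤a = <⇒≱ inv< (subst₂ (λ w w′ → inv w′ ≤ inv w) (sym w≡) (sym w′≡) (inv-swap-≤ u t b≤a))

⊆-swap : ∀ u {a b : ℕ} t {p} → p ⊆ u ++ a ∷ b ∷ t → p ⊆ u ++ b ∷ a ∷ t ⊎ (a ∷ b ∷ []) ⊆ p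
⊆-swap []      t (a ∷ʳ (b ∷ʳ p⊆))   = inj₁ (b ∷ʳ (a ∷ʳ p⊆))
⊆-swap []      t (a ∷ʳ (refl ∷ p⊆)) = inj₁ (refl ∷ (a ∷ʳ p⊆))
⊆-swap []      t (refl ∷ (b ∷ʳ p⊆)) = inj₁ (b ∷ʳ (refl ∷ p⊆))
⊆-swap []      t (refl ∷ (refl ∷ _)) = inj₂ (refl ∷ refl ∷ minimum _)
⊆-swap (x ∷ u) t (x ∷ʳ p⊆)   = Sum.map (x ∷ʳ_) id (⊆-swap u t p⊆)
⊆-swap (x ∷ u) t (refl ∷ p⊆) = Sum.map (refl ∷_) (x ∷ʳ_) (⊆-swap u t p⊆)

pair-in-321 : ∀ {x y c b a} → (x ∷ y ∷ []) ⊆ (c ∷ b ∷ a ∷ []) → b < c → a < b → y < x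
pair-in-321 (refl ∷ refl ∷ _)          b<c _   = b<c
pair-in-321 (refl ∷ _ ∷ʳ refl ∷ _)     b<c a<b = <-trans a<b b<c
pair-in-321 (_ ∷ʳ refl ∷ refl ∷ _)     _   a<b = a<b
pair-in-321 (_ ∷ʳ _ ∷ʳ _ ∷ ())
pair-in-321 (_ ∷ʳ _ ∷ʳ _ ∷ʳ ())

FC-swap⁻ : ∀ u {a b} t → a < b → FullyCommutative (u ++ b ∷ a ∷ t) → FullyCommutative (u ++ a ∷ b ∷ t)
FC-swap⁻ u t a<b fc (c , b′ , a′ , cba⊆ , b′<c , a′<b′) with ⊆-swap u t cba⊆
... | inj₁ cba⊆′ = fc (c , b′ , a′ , cba⊆′ , b′<c , a′<b′)
... | inj₂ ab⊆   = <-asym a<b (pair-in-321 ab⊆ b′<c a′<b′)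

AscentSwap-Unique : ∀ {w v} → AscentSwap w v → Unique w → Unique v
AscentSwap-Unique (ascent-swap u t _) = Unique-resp-↭ (++⁺ˡ u (swap _ _ refl))

AscentSwap-FC⁻ : ∀ {w v} → AscentSwap w v → FullyCommutative v → FullyCommutative w
AscentSwap-FC⁻ (ascent-swap u t a<b) = FC-swap⁻ u t a<b

≤R-FC⁻ : ∀ {w v} → w ≤R v → FullyCommutative v → FullyCommutative w
≤R-FC⁻ ε         fc = fc
≤R-FC⁻ (s ◅ w≤v) fc = AscentSwap-FC⁻ (WeakStep⇒AscentSwap s) (≤R-FC⁻ w≤v fc)

row₂-sublist : ∀ {w v} → AscentSwap w v → Unique w → FullyCommutative v → Row2 (P w) ⊆ Row2 (P v)
row₂-sublist sw@(ascent-swap u t a<b) un fc =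
  increasing-sublist (TwoRowTableau.row₂-increasing (P-tableau _ w-ok))
                     (TwoRowTableau.row₂-increasing (P-tableau _ v-ok))
                     (row₂-swap-⊆ u t a<b w-ok v-ok)
  where
  w-ok = un , AscentSwap-FC⁻ sw fc
  v-ok = AscentSwap-Unique sw un , fc

≤R-row₂-sublist : ∀ {w v} → w ≤R v → Unique w → FullyCommutative v → Row2 (P w) ⊆ Row2 (P v)
≤R-row₂-sublist ε         _  _  = ⊆-refl
≤R-row₂-sublist (s ◅ w≤v) un fc =
  ⊆-trans (row₂-sublist sw un (≤R-FC⁻ w≤v fc)) (≤R-row₂-sublist w≤v (AscentSwap-Unique sw un) fc)
  where
  sw = WeakStep⇒AscentSwap s

CrowdedSet-mono : ∀ {L₁ L₂} → L₁ ⊆ L₂ → CrowdedSet L₁ → CrowdedSet L₂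
CrowdedSet-mono L₁⊆L₂ (x , y , x>0 , crowded) =
  x , y , x>0 , <-≤-trans crowded (length-mono-≤ (filter⁺ _ _ (λ { refl → id }) L₁⊆L₂))

-- Full commutativity of w follows from that of v, and v is not required to be a permutation.
lemma5p1 : (n : ℕ) (w v : List ℕ) →
    IsPerm n w → IsPerm n v →
    FullyCommutative w → FullyCommutative v →
    w ≤R v →
    (Uncrowded v → Uncrowded w) × (Crowded w → Crowded v)
lemma5p1 n w v w-perm _ _ fc-v w≤v = (λ uncrowded-v → uncrowded-v ∘ crowded-up) , crowded-up
  where
  crowded-up : Crowded w → Crowded v
  crowded-up = CrowdedSet-mono (≤R-row₂-sublist w≤v (IsPerm⇒Unique n w-perm) fc-v)
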